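{- Let $k$ be a positive integer and let $(G,*)$ be a groupoid such that for all $n$ and all $s,t\in \mathcal{F}_n$, we have $s^*=t^*$ whenever $s$ and $t$ have the same leftmost variable $x_i$ and the left depths of $x_i$ in $s$ and in $t$ are congruent modulo $k$. Then $s_n(*) \le k$ and $s^{ac}_n(*) \le kn$ for $n=k+1,k+2,\ldots$, where the first inequality holds as an equality if the second does. Moreover, both upper bounds are reached if the groupoid satisfies the stronger condition that for all $s,t\in\mathcal{F}_n$, $s^*=t^*$ if and only if $s$ and $t$ have the same leftmost variable $x_i$ and the left depths of $x_i$ in $s$ and in $t$ are congruent modulo $k$.
   Context: A groupoid $(G,*)$ is a set $G$ with a binary operation $*$. Fix distinct variables $x_1,x_2,\ldots$. $\mathcal{B}_n$ is the set of all bracketings of the word $x_1x_2\cdots x_n$, and $\mathcal{F}_n$ is the set of full linear terms over $x_1,\ldots,x_n$, obtained by permuting the variables in bracketings of $x_1,\ldots,x_n$ (so $\mathcal{B}_n\subseteq\mathcal{F}_n$). Each term $t\in\mathcal{F}_n$ induces an $n$-ary term operation $t^*$ on $(G,*)$. The associative spectrum is $s_n(*) := |\{t^*: t\in\mathcal{B}_n\}|$ and the associative-commutative spectrum (ac-spectrum) is $s^{ac}_n(*) := |\{t^*: t\in\mathcal{F}_n\}|$. Each term corresponds to a full binary tree with leaves labeled by its variables; the left depth of a leaf (variable) is the number of left edges on the unique path from that leaf to the root. -}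

module Defs where

open import Data.Nat using (ℕ; zero; suc; NonZero)
open import Data.Nat.DivMod using (_%_)
open import Data.Fin using (Fin)
open import Data.List using (List; [_]; _++_; allFin)
open import Data.List.Relation.Binary.Permutation.Propositional using (_↭_)
open import Data.Product using (Σ; ∃; _×_)
open import Relation.Binary.PropositionalEquality using (_≡_; _≢_)
open import Relation.Nullary using (¬_)

data Term (n : ℕ) : Set where
  var : Fin n → Term n
  _·_ : Term n → Term n → Term n

leaves : {n : ℕ} → Term n → List (Fin n)
leaves (var i) = [ i ]
leaves (s · t) = leaves s ++ leaves t

-- B_n : bracketings of x_1 x_2 ... x_n (variables in order, each once)
IsBracketing : {n : ℕ} → Term n → Set
IsBracketing {n} t = leaves t ≡ allFin n

-- F_n : full linear terms (each variable exactly once, in any order)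
IsFull : {n : ℕ} → Term n → Set
IsFull {n} t = leaves t ↭ allFin n

eval : {G : Set} → (G → G → G) → {n : ℕ} → Term n → (Fin n → G) → G
eval _*_ (var i) ρ = ρ i
eval _*_ (s · t) ρ = eval _*_ s ρ * eval _*_ t ρ

SameOp : {G : Set} → (G → G → G) → {n : ℕ} → Term n → Term n → Set
SameOp {G} _*_ {n} s t = (ρ : Fin n → G) → eval _*_ s ρ ≡ eval _*_ t ρ

leftmost : {n : ℕ} → Term n → Fin n
leftmost (var i) = i
leftmost (s · t) = leftmost s

leftDepth : {n : ℕ} → Term n → ℕ
leftDepth (var i) = zero
leftDepth (s · t) = suc (leftDepth s)

-- |{ t^* : t ∈ P }| ≤ m : there are m functions G^n → G covering all t^*
OpsAtMost : {G : Set} → (G → G → G) → {n : ℕ} → (Term n → Set) → ℕ → Set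
OpsAtMost {G} _*_ {n} P m =
  Σ (Fin m → ((Fin n → G) → G)) λ f →
    (t : Term n) → P t → ∃ λ i → (ρ : Fin n → G) → eval _*_ t ρ ≡ f i ρ

-- |{ t^* : t ∈ P }| ≥ m : there are m terms in P with pairwise distinct term operations
OpsAtLeast : {G : Set} → (G → G → G) → {n : ℕ} → (Term n → Set) → ℕ → Set
OpsAtLeast {G} _*_ {n} P m =
  Σ (Fin m → Term n) λ f →
    ((i : Fin m) → P (f i)) ×
    ((i j : Fin m) → i ≢ j → ¬ SameOp _*_ (f i) (f j))

OpsExactly : {G : Set} → (G → G → G) → {n : ℕ} → (Term n → Set) → ℕ → Set
OpsExactly _*_ P m = OpsAtMost _*_ P m × OpsAtLeast _*_ P m

-- s_n(*) ≤ m, s_n(*) = m, s^ac_n(*) ≤ m, s^ac_n(*) = m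
SpecAtMost SpecEq ACSpecAtMost ACSpecEq : {G : Set} → (G → G → G) → ℕ → ℕ → Set
SpecAtMost _*_ n m = OpsAtMost _*_ (IsBracketing {n}) m
SpecEq _*_ n m = OpsExactly _*_ (IsBracketing {n}) m
ACSpecAtMost _*_ n m = OpsAtMost _*_ (IsFull {n}) m
ACSpecEq _*_ n m = OpsExactly _*_ (IsFull {n}) m

LeftRel : (k : ℕ) → .{{_ : NonZero k}} → {n : ℕ} → Term n → Term n → Set
LeftRel k s t = (leftmost s ≡ leftmost t) × (leftDepth s % k ≡ leftDepth t % k)

WeakCond : (k : ℕ) → .{{_ : NonZero k}} → {G : Set} → (G → G → G) → Set
WeakCond k _*_ = (n : ℕ) (s t : Term n) → IsFull s → IsFull t →
  LeftRel k s t → SameOp _*_ s t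

StrongCond : (k : ℕ) → .{{_ : NonZero k}} → {G : Set} → (G → G → G) → Set
StrongCond k _*_ = (n : ℕ) (s t : Term n) → IsFull s → IsFull t →
  (LeftRel k s t → SameOp _*_ s t) × (SameOp _*_ s t → LeftRel k s t)

-- Under the weak condition the operation of a full term depends only on its leftmost
-- variable x_j and on its left depth modulo k. For n > k the left depths 1, …, k are all
-- realised by full terms with any prescribed leftmost variable, so one canonical term for
-- each of the k·n pairs (residue, variable) covers all full terms, and the k canonical
-- terms with leftmost variable x_1 cover all bracketings. Under the strong condition the
-- canonical terms are pairwise inequivalent. If the ac-spectrum is exactly kn, then kn
-- pairwise distinct operations are covered by the kn canonical ones, which forces the
-- canonical operations, in particular those of the canonical bracketings, to be distinct.
module Submission where

open import Defs
open import Data.Nat using (ℕ; zero; suc; _+_; _*_; _≤_; _<_; s≤s; NonZero)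
open import Data.Nat.Properties using (+-suc; +-identityʳ; suc-injective; <-≤-trans; 1+n≰n)
open import Data.Nat.Divisibility using (∣-refl)
open import Data.Nat.DivMod using (_%_; _mod_; %-distribˡ-+; m%n%n≡m%n; %-remove-+ˡ; m<n⇒m%n≡m)
open import Data.Fin using (Fin; toℕ; combine; remQuot; punchIn; punchOut; _≟_)
open import Data.Fin.Properties
  using (toℕ-fromℕ<; toℕ-injective; toℕ<n; remQuot-combine; combine-remQuot; combine-injectiveˡ; punchIn-punchOut; injective⇒≤)
open import Data.List using (List; []; _∷_; [_]; _++_; allFin; length; tabulate)
open import Data.List.Properties using (++-identityʳ; ++-assoc; ∷-injectiveˡ; length-tabulate)
open import Data.List.Membership.Propositional.Properties using (∈-∃++; ∈-allFin)
open import Data.List.Relation.Binary.Permutation.Propositional using (_↭_; ↭-refl; ↭-sym; ↭-reflexive; ↭-trans)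
open import Data.List.Relation.Binary.Permutation.Propositional.Properties using (shift; ↭-length)
open import Data.Product using (Σ; ∃; _×_; _,_; proj₁; proj₂; uncurry)
open import Data.Empty using (⊥-elim)
open import Function using (_∘_)
open import Function.Definitions using (Injective)
open import Relation.Nullary using (¬_; yes; no)
open import Relation.Binary.PropositionalEquality hiding ([_])

covering-distinct : {G : Set} {_∙_ : G → G → G} {n N : ℕ} {P : Term n → Set} →
  (cover : OpsAtMost _∙_ P N) → OpsAtLeast _∙_ P N →
  (i j : Fin N) → i ≢ j → ¬ ((ρ : Fin n → G) → proj₁ cover i ρ ≡ proj₁ cover j ρ)
covering-distinct {_∙_ = _∙_} {N = suc N} (f , covers) (T , PT , distinct) i j i≢j fi≗fj =
  1+n≰n (injective⇒≤ {f = index} index-injective)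
  where
    -- since f j agrees with f i, the index j can be avoided, leaving only N indices
    reindex : (a : Fin (suc N)) → Σ (Fin N) λ c → ∀ ρ → eval _∙_ (T a) ρ ≡ f (punchIn j c) ρ
    reindex a with covers (T a) (PT a)
    ... | c , Ta≗fc with c ≟ j
    ...   | yes refl = punchOut (i≢j ∘ sym) , λ ρ →
            trans (Ta≗fc ρ) (trans (sym (fi≗fj ρ)) (cong (λ x → f x ρ) (sym (punchIn-punchOut _))))
    ...   | no c≢j = punchOut (c≢j ∘ sym) , λ ρ →
            trans (Ta≗fc ρ) (cong (λ x → f x ρ) (sym (punchIn-punchOut _)))

    index : Fin (suc N) → Fin N
    index a = proj₁ (reindex a)

    index-injective : Injective _≡_ _≡_ index
    index-injective {a} {b} eq with a ≟ b
    ... | yes a≡b = a≡b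
    ... | no a≢b = ⊥-elim (distinct a b a≢b λ ρ →
            trans (proj₂ (reindex a) ρ) (trans (cong (λ c → f (punchIn j c) ρ) eq) (sym (proj₂ (reindex b) ρ))))

module _ {n : ℕ} where
  rightComb : Fin n → List (Fin n) → Term n
  rightComb z [] = var z
  rightComb z (y ∷ ys) = var z · rightComb y ys

  spine : Term n → ℕ → List (Fin n) → Term n
  spine t _ [] = t
  spine t zero (z ∷ zs) = t · rightComb z zs
  spine t (suc d) (z ∷ zs) = spine (t · var z) d zs

  leaves-rightComb : ∀ z zs → leaves (rightComb z zs) ≡ z ∷ zs
  leaves-rightComb z [] = refl
  leaves-rightComb z (y ∷ ys) = cong (z ∷_) (leaves-rightComb y ys)

  leaves-spine : ∀ t d zs → leaves (spine t d zs) ≡ leaves t ++ zs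
  leaves-spine t d [] = sym (++-identityʳ (leaves t))
  leaves-spine t zero (z ∷ zs) = cong (leaves t ++_) (leaves-rightComb z zs)
  leaves-spine t (suc d) (z ∷ zs) = trans (leaves-spine (t · var z) d zs) (++-assoc (leaves t) [ z ] zs)

  leftmost-spine : ∀ t d zs → leftmost (spine t d zs) ≡ leftmost t
  leftmost-spine t d [] = refl
  leftmost-spine t zero (z ∷ zs) = refl
  leftmost-spine t (suc d) (z ∷ zs) = leftmost-spine (t · var z) d zs

  leftDepth-spine : ∀ t d zs → d < length zs → leftDepth (spine t d zs) ≡ suc d + leftDepth t
  leftDepth-spine t zero (z ∷ zs) _ = refl
  leftDepth-spine t (suc d) (z ∷ zs) (s≤s d<len) =
    trans (leftDepth-spine (t · var z) d zs d<len) (cong suc (+-suc d (leftDepth t)))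

  leaves-leftmost : (t : Term n) → ∃ λ xs → leaves t ≡ leftmost t ∷ xs
  leaves-leftmost (var i) = [] , refl
  leaves-leftmost (s · t) with xs , eq ← leaves-leftmost s = xs ++ leaves t , cong (_++ leaves t) eq

bracketing-leftmost : {m : ℕ} (t : Term (suc m)) → IsBracketing t → leftmost t ≡ Fin.zero
bracketing-leftmost t bt with xs , eq ← leaves-leftmost t = ∷-injectiveˡ (trans (sym eq) bt)

m%d≡n%d⇒[o+m]%d≡[o+n]%d : ∀ {m n} o d .{{_ : NonZero d}} → m % d ≡ n % d → (o + m) % d ≡ (o + n) % d
m%d≡n%d⇒[o+m]%d≡[o+n]%d {m} {n} o d eq = begin
  (o + m) % d            ≡⟨ %-distribˡ-+ o m d ⟩
  (o % d + m % d) % d    ≡⟨ cong (λ r → (o % d + r) % d) eq ⟩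
  (o % d + n % d) % d    ≡⟨ %-distribˡ-+ o n d ⟨
  (o + n) % d            ∎
  where open ≡-Reasoning

module Residue (k' : ℕ) where
  k : ℕ
  k = suc k'

  -- the index i with i + 1 ≡ L (mod k): canonical terms realise the depths 1, …, k, not 0, …, k - 1
  residue : ℕ → Fin k
  residue L = (k' + L) mod k

  residue-spec : ∀ L → suc (toℕ (residue L)) % k ≡ L % k
  residue-spec L = begin
    suc (toℕ (residue L)) % k ≡⟨ cong (λ r → suc r % k) (toℕ-fromℕ< _) ⟩
    (1 + (k' + L) % k) % k    ≡⟨ m%d≡n%d⇒[o+m]%d≡[o+n]%d 1 k (m%n%n≡m%n (k' + L) k) ⟩
    (k + L) % k               ≡⟨ %-remove-+ˡ L ∣-refl ⟩
    L % k                     ∎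
    where open ≡-Reasoning

  residue-cong : ∀ {L L'} → L % k ≡ L' % k → residue L ≡ residue L'
  residue-cong eq = toℕ-injective (trans (toℕ-fromℕ< _)
    (trans (m%d≡n%d⇒[o+m]%d≡[o+n]%d k' k eq) (sym (toℕ-fromℕ< _))))

  residue-suc-toℕ : (i : Fin k) → residue (suc (toℕ i)) ≡ i
  residue-suc-toℕ i = toℕ-injective (begin
    toℕ (residue (suc (toℕ i))) ≡⟨ toℕ-fromℕ< _ ⟩
    (k' + suc (toℕ i)) % k      ≡⟨ cong (_% k) (+-suc k' (toℕ i)) ⟩
    (k + toℕ i) % k             ≡⟨ %-remove-+ˡ (toℕ i) ∣-refl ⟩
    toℕ i % k                   ≡⟨ m<n⇒m%n≡m (toℕ<n i) ⟩
    toℕ i                       ∎)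
    where open ≡-Reasoning

  suc-toℕ-%-injective : (i j : Fin k) → suc (toℕ i) % k ≡ suc (toℕ j) % k → i ≡ j
  suc-toℕ-%-injective i j eq =
    trans (sym (residue-suc-toℕ i)) (trans (residue-cong eq) (residue-suc-toℕ j))

module Canonical (k' m : ℕ) (k≤m : suc k' ≤ m) where
  open Residue k' public

  n : ℕ
  n = suc m

  Listing : Fin n → List (Fin n) → Set
  Listing y zs = y ∷ zs ↭ allFin n

  listing-length : ∀ {y zs} → Listing y zs → length zs ≡ m
  listing-length p = suc-injective (trans (↭-length p) (length-tabulate (λ x → x)))

  listing : (j : Fin n) → Σ (List (Fin n)) (Listing j)
  listing j with as , bs , eq ← ∈-∃++ (∈-allFin j) =
    as ++ bs , ↭-sym (↭-trans (↭-reflexive eq) (shift j as bs))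

  canonical : Fin n → List (Fin n) → Fin k → Term n
  canonical y zs i = spine (var y) (toℕ i) zs

  canonical-full : ∀ {y zs} i → Listing y zs → IsFull (canonical y zs i)
  canonical-full {y} {zs} i p = subst (_↭ allFin n) (sym (leaves-spine (var y) (toℕ i) zs)) p

  canonical-leftDepth : ∀ {y zs} i → Listing y zs → leftDepth (canonical y zs i) ≡ suc (toℕ i)
  canonical-leftDepth {y} {zs} i p = trans (leftDepth-spine (var y) (toℕ i) zs i<length) (cong suc (+-identityʳ (toℕ i)))
    where
      i<length : toℕ i < length zs
      i<length = subst (toℕ i <_) (sym (listing-length p)) (<-≤-trans (toℕ<n i) k≤m)

  LeftRel-canonical : ∀ (t : Term n) {y zs} → leftmost t ≡ y → Listing y zs →
    LeftRel k t (canonical y zs (residue (leftDepth t)))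
  LeftRel-canonical t {y} {zs} t≡y p =
    trans t≡y (sym (leftmost-spine (var y) _ zs)) ,
    trans (sym (residue-spec (leftDepth t))) (cong (_% k) (sym (canonical-leftDepth _ p)))

  canonical-LeftRel : ∀ {y zs zs'} i → Listing y zs → Listing y zs' →
    LeftRel k (canonical y zs i) (canonical y zs' i)
  canonical-LeftRel {y} {zs} {zs'} i p p' =
    trans (leftmost-spine (var y) _ zs) (sym (leftmost-spine (var y) _ zs')) ,
    cong (_% k) (trans (canonical-leftDepth i p) (sym (canonical-leftDepth i p')))

  LeftRel-canonical-injective : ∀ {y y' zs zs'} i i' → Listing y zs → Listing y' zs' →
    LeftRel k (canonical y zs i) (canonical y' zs' i') → y ≡ y' × i ≡ i'
  LeftRel-canonical-injective {y} {y'} {zs} {zs'} i i' p p' (same-leftmost , same-depth) =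
    trans (sym (leftmost-spine (var y) _ zs)) (trans same-leftmost (leftmost-spine (var y') _ zs')) ,
    suc-toℕ-%-injective i i' (begin
      suc (toℕ i) % k                        ≡⟨ cong (_% k) (canonical-leftDepth i p) ⟨
      leftDepth (canonical y zs i) % k       ≡⟨ same-depth ⟩
      leftDepth (canonical y' zs' i') % k    ≡⟨ cong (_% k) (canonical-leftDepth i' p') ⟩
      suc (toℕ i') % k                       ∎)
    where open ≡-Reasoning

  ordered : Listing Fin.zero (tabulate Fin.suc)
  ordered = ↭-refl

  bracketing : Fin k → Term n
  bracketing = canonical Fin.zero (tabulate Fin.suc)

  bracketing-IsBracketing : ∀ i → IsBracketing (bracketing i)
  bracketing-IsBracketing i = leaves-spine (var Fin.zero) (toℕ i) (tabulate Fin.suc)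

  representative : Fin k × Fin n → Term n
  representative (i , j) = canonical j (proj₁ (listing j)) i

  representative-full : ∀ p → IsFull (representative p)
  representative-full (i , j) = canonical-full i (proj₂ (listing j))

  representative-injective : ∀ p q → LeftRel k (representative p) (representative q) → p ≡ q
  representative-injective (i , j) (i' , j') rel
    with refl , refl ← LeftRel-canonical-injective i i' (proj₂ (listing j)) (proj₂ (listing j')) rel = refl

  module Weak (G : Set) (_∙_ : G → G → G) (weak : WeakCond k _∙_) where
    ≈canonical : ∀ t {y zs} → IsFull t → leftmost t ≡ y → (p : Listing y zs) →
      SameOp _∙_ t (canonical y zs (residue (leftDepth t)))
    ≈canonical t {y} {zs} ft t≡y p = weak n t (canonical y zs (residue (leftDepth t))) ft
      (canonical-full _ p) (LeftRel-canonical t t≡y p)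

    specAtMost : SpecAtMost _∙_ n k
    specAtMost = eval _∙_ ∘ bracketing , λ t bt →
      residue (leftDepth t) , ≈canonical t (↭-reflexive bt) (bracketing-leftmost t bt) ordered

    acAtMost : ACSpecAtMost _∙_ n (k * n)
    acAtMost = eval _∙_ ∘ representative ∘ remQuot {k} n , λ t ft →
      combine (residue (leftDepth t)) (leftmost t) ,
      subst (SameOp _∙_ t ∘ representative) (sym (remQuot-combine (residue (leftDepth t)) (leftmost t)))
        (≈canonical t ft refl (proj₂ (listing (leftmost t))))

    bracketing≈representative : ∀ i → SameOp _∙_ (bracketing i) (representative (remQuot {k} n (combine i Fin.zero)))
    bracketing≈representative i =
      subst (SameOp _∙_ (bracketing i) ∘ representative) (sym (remQuot-combine i Fin.zero))
        (weak n (bracketing i) (representative (i , Fin.zero)) (canonical-full i ordered) (representative-full (i , Fin.zero))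
          (canonical-LeftRel i ordered (proj₂ (listing Fin.zero))))

    acSpecEq⇒specEq : ACSpecEq _∙_ n (k * n) → SpecEq _∙_ n k
    acSpecEq⇒specEq (_ , acAtLeast) = specAtMost , bracketing , bracketing-IsBracketing , distinct
      where
        distinct : ∀ i i' → i ≢ i' → ¬ SameOp _∙_ (bracketing i) (bracketing i')
        distinct i i' i≢i' same = covering-distinct acAtMost acAtLeast (combine i Fin.zero) (combine i' Fin.zero)
          (i≢i' ∘ combine-injectiveˡ i Fin.zero i' Fin.zero)
          λ ρ → trans (sym (bracketing≈representative i ρ)) (trans (same ρ) (bracketing≈representative i' ρ))

  module Strong (G : Set) (_∙_ : G → G → G) (strong : StrongCond k _∙_) where
    open Weak G _∙_ (λ n s t fs ft → proj₁ (strong n s t fs ft))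

    specEq : SpecEq _∙_ n k
    specEq = specAtMost , bracketing , bracketing-IsBracketing , λ i i' i≢i' same →
      i≢i' (proj₂ (LeftRel-canonical-injective i i' ordered ordered
        (proj₂ (strong n (bracketing i) (bracketing i') (canonical-full i ordered) (canonical-full i' ordered)) same)))

    representative-SameOp-injective : ∀ p q → SameOp _∙_ (representative p) (representative q) → p ≡ q
    representative-SameOp-injective p q same = representative-injective p q
      (proj₂ (strong n (representative p) (representative q) (representative-full p) (representative-full q)) same)

    acSpecEq : ACSpecEq _∙_ n (k * n)
    acSpecEq = acAtMost , representative ∘ remQuot {k} n , representative-full ∘ remQuot {k} n , λ x x' x≢x' same →
      x≢x' (begin
        x                                ≡⟨ combine-remQuot {k} n x ⟨
        uncurry combine (remQuot {k} n x)    ≡⟨ cong (uncurry combine) (representative-SameOp-injective (remQuot {k} n x) (remQuot {k} n x') same) ⟩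
        uncurry combine (remQuot {k} n x')   ≡⟨ combine-remQuot {k} n x' ⟩
        x'                               ∎)
      where open ≡-Reasoning

theorem6p2 : (k : ℕ) → .{{_ : NonZero k}} →
    ((G : Set) (_∙_ : G → G → G) → WeakCond k _∙_ →
      (n : ℕ) → suc k ≤ n →
        SpecAtMost _∙_ n k × ACSpecAtMost _∙_ n (k * n) ×
        (ACSpecEq _∙_ n (k * n) → SpecEq _∙_ n k)) ×
    ((G : Set) (_∙_ : G → G → G) → StrongCond k _∙_ →
      (n : ℕ) → suc k ≤ n →
        SpecEq _∙_ n k × ACSpecEq _∙_ n (k * n))
theorem6p2 (suc k') =
  (λ { G _∙_ weak (suc m) (s≤s k≤m) → let open Canonical.Weak k' m k≤m G _∙_ weak
         in specAtMost , acAtMost , acSpecEq⇒specEq }) ,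
  (λ { G _∙_ strong (suc m) (s≤s k≤m) → let open Canonical.Strong k' m k≤m G _∙_ strong
         in specEq , acSpecEq })
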